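{- Let $\Gamma\vdash P$ and $\Gamma\vdash P'$ be processes, let $E: P\xrightarrow{a} R$ be a transition, and suppose $P\cong P'$ (braiding congruence). Then there exist a process $R'$, a transition $P'\xrightarrow{a}R'$ (with the same action $a$), and a braiding congruence $R\cong R'$.
   Context: Names are de Bruijn indices; a context $\Gamma$ is a natural number identified with $\{0,\dots,\Gamma-1\}$. Processes: $P::=0\mid x.P\mid\overline{x}\langle y\rangle.P\mid P+Q\mid P\mid Q\mid\nu P\mid !P$, where input $x.P$ and $\nu P$ bind index $0$ in $P$; $\Gamma\vdash P$ means all free indices of $P$ lie in $\Gamma$ (the body of a binder being scoped in $\Gamma+1$). Actions over $\Gamma$: input $x$ and bound output $\overline{x}$ ($x\in\Gamma$) are bound actions with target context $\Gamma+1$; output $\overline{x}\langle y\rangle$ ($x,y\in\Gamma$) and $\tau$ are non-bound with target context $\Gamma$; $b$ ranges over bound, $c$ over non-bound actions. Renamings $\rho:\Gamma\to\Delta$ are arbitrary functions; $\mathsf{push}\,x=x+1$; $\mathsf{pop}\,y$ sends $0\mapsto y$, $x+1\mapsto x$; $\mathsf{swap}$ exchanges $0,1$ and fixes $x+2$; $(\rho+1)0=0$, $(\rho+1)(x+1)=\rho x+1$. Renaming of processes: $\rho^*0=0$, $\rho^*(x.P)=(\rho x).((\rho+1)^*P)$, $\rho^*(\overline{x}\langle y\rangle.P)=\overline{\rho x}\langle\rho y\rangle.\rho^*P$, $\rho^*$ commutes with $+$, $\mid$, $!$, and $\rho^*(\nu P)=\nu((\rho+1)^*P)$; on actions $\rho^*$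 renames all names, $\rho^*\tau=\tau$. Transitions $P\xrightarrow{a}R$ are inductively generated by: $x.P\xrightarrow{x}P$; $\overline{x}\langle y\rangle.P\xrightarrow{\overline{x}\langle y\rangle}P$; $P\xrightarrow{a}R\Rightarrow P+Q\xrightarrow{a}R$ and $Q\xrightarrow{a}S\Rightarrow P+Q\xrightarrow{a}S$; $P\xrightarrow{c}R\Rightarrow P\mid Q\xrightarrow{c}R\mid Q$; $P\xrightarrow{b}R\Rightarrow P\mid Q\xrightarrow{b}R\mid\mathsf{push}^*Q$; $Q\xrightarrow{c}S\Rightarrow P\mid Q\xrightarrow{c}P\mid S$; $Q\xrightarrow{b}S\Rightarrow P\mid Q\xrightarrow{b}\mathsf{push}^*P\mid S$; $P\xrightarrow{x}R,\ Q\xrightarrow{\overline{x}\langle y\rangle}S\Rightarrow P\mid Q\xrightarrow{\tau}(\mathsf{pop}\,y)^*R\mid S$; $P\xrightarrow{\overline{x}\langle y\rangle}R,\ Q\xrightarrow{x}S\Rightarrow P\mid Q\xrightarrow{\tau}R\mid(\mathsf{pop}\,y)^*S$; $P\xrightarrow{\overline{x+1}\langle 0\rangle}R\Rightarrow\nu P\xrightarrow{\overline{x}}R$; $P\xrightarrow{x}R,\ Q\xrightarrow{\overline{x}}S\Rightarrow P\mid Q\xrightarrow{\tau}\nu(R\mid S)$; $P\xrightarrow{\overline{x}}R,\ Q\xrightarrow{x}S\Rightarrow P\mid Q\xrightarrow{\tau}\nu(R\mid S)$; $P\xrightarrow{\mathsf{push}^*c}R\Rightarrow\nu P\xrightarrow{c}\nu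 R$; $P\xrightarrow{\mathsf{push}^*b}R\Rightarrow\nu P\xrightarrow{b}\nu(\mathsf{swap}^*R)$; $P\mid !P\xrightarrow{a}R\Rightarrow !P\xrightarrow{a}R$. Braiding congruence $\cong$ is inductively generated by: $\nu\nu(\mathsf{swap}^*P)\cong\nu\nu P$; $\nu\nu P\cong\nu\nu(\mathsf{swap}^*P)$; transitivity; $0\cong0$; and compatibility with each constructor ($P\cong R$ implies $x.P\cong x.R$, $\overline{x}\langle y\rangle.P\cong\overline{x}\langle y\rangle.R$, $\nu P\cong\nu R$, $!P\cong !R$; $P\cong R$ and $Q\cong S$ imply $P+Q\cong R+S$ and $P\mid Q\cong R\mid S$). -}

module Defs where

open import Data.Nat using (ℕ; zero; suc)
open import Data.Fin using (Fin; zero; suc)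

Ren : ℕ → ℕ → Set
Ren Γ Δ = Fin Γ → Fin Δ

push : ∀ {Γ} → Ren Γ (suc Γ)
push x = suc x

pop : ∀ {Γ} → Fin Γ → Ren (suc Γ) Γ
pop y zero    = y
pop y (suc x) = x

swap : ∀ {Γ} → Ren (suc (suc Γ)) (suc (suc Γ))
swap zero          = suc zero
swap (suc zero)    = zero
swap (suc (suc x)) = suc (suc x)

lift : ∀ {Γ Δ} → Ren Γ Δ → Ren (suc Γ) (suc Δ)
lift ρ zero    = zero
lift ρ (suc x) = suc (ρ x)

-- Processes scoped in Γ (Proc Γ is exactly the P with Γ ⊢ P)
infixr 6 _+_
infixr 5 _∣_
infix 8 !_
data Proc (Γ : ℕ) : Set where
  𝟘    : Proc Γ
  inp  : Fin Γ → Proc (suc Γ) → Proc Γ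
  out  : Fin Γ → Fin Γ → Proc Γ → Proc Γ
  _+_  : Proc Γ → Proc Γ → Proc Γ
  _∣_  : Proc Γ → Proc Γ → Proc Γ
  ν    : Proc (suc Γ) → Proc Γ
  !_   : Proc Γ → Proc Γ

ren : ∀ {Γ Δ} → Ren Γ Δ → Proc Γ → Proc Δ
ren ρ 𝟘         = 𝟘
ren ρ (inp x P) = inp (ρ x) (ren (lift ρ) P)
ren ρ (out x y P) = out (ρ x) (ρ y) (ren ρ P)
ren ρ (P + Q)   = ren ρ P + ren ρ Q
ren ρ (P ∣ Q)   = ren ρ P ∣ ren ρ Q
ren ρ (ν P)     = ν (ren (lift ρ) P)
ren ρ (! P)     = ! ren ρ P

data BAct (Γ : ℕ) : Set where
  binp : Fin Γ → BAct Γ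
  bout : Fin Γ → BAct Γ

data CAct (Γ : ℕ) : Set where
  cout : Fin Γ → Fin Γ → CAct Γ
  τ    : CAct Γ

data Act (Γ : ℕ) : ℕ → Set where
  bnd : BAct Γ → Act Γ (suc Γ)
  nb  : CAct Γ → Act Γ Γ

renB : ∀ {Γ Δ} → Ren Γ Δ → BAct Γ → BAct Δ
renB ρ (binp x) = binp (ρ x)
renB ρ (bout x) = bout (ρ x)

renC : ∀ {Γ Δ} → Ren Γ Δ → CAct Γ → CAct Δ
renC ρ (cout x y) = cout (ρ x) (ρ y)
renC ρ τ          = τ

infix 4 _—[_]→_ _≅_
data _—[_]→_ {Γ : ℕ} : ∀ {Γ'} → Proc Γ → Act Γ Γ' → Proc Γ' → Set where
  inp-ax  : ∀ {x P} → inp x P —[ bnd (binp x) ]→ P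
  out-ax  : ∀ {x y P} → out x y P —[ nb (cout x y) ]→ P
  sum-l   : ∀ {Γ'} {a : Act Γ Γ'} {P Q R} → P —[ a ]→ R → (P + Q) —[ a ]→ R
  sum-r   : ∀ {Γ'} {a : Act Γ Γ'} {P Q S} → Q —[ a ]→ S → (P + Q) —[ a ]→ S
  par-l-c : ∀ {c P Q R} → P —[ nb c ]→ R → (P ∣ Q) —[ nb c ]→ (R ∣ Q)
  par-l-b : ∀ {b P Q R} → P —[ bnd b ]→ R → (P ∣ Q) —[ bnd b ]→ (R ∣ ren push Q)
  par-r-c : ∀ {c P Q S} → Q —[ nb c ]→ S → (P ∣ Q) —[ nb c ]→ (P ∣ S)
  par-r-b : ∀ {b P Q S} → Q —[ bnd b ]→ S → (P ∣ Q) —[ bnd b ]→ (ren push P ∣ S)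
  comm-l  : ∀ {x y P Q R S} → P —[ bnd (binp x) ]→ R → Q —[ nb (cout x y) ]→ S
            → (P ∣ Q) —[ nb τ ]→ (ren (pop y) R ∣ S)
  comm-r  : ∀ {x y P Q R S} → P —[ nb (cout x y) ]→ R → Q —[ bnd (binp x) ]→ S
            → (P ∣ Q) —[ nb τ ]→ (R ∣ ren (pop y) S)
  open-ν  : ∀ {x P R} → P —[ nb (cout (suc x) zero) ]→ R → ν P —[ bnd (bout x) ]→ R
  close-l : ∀ {x P Q R S} → P —[ bnd (binp x) ]→ R → Q —[ bnd (bout x) ]→ S
            → (P ∣ Q) —[ nb τ ]→ ν (R ∣ S)
  close-r : ∀ {x P Q R S} → P —[ bnd (bout x) ]→ R → Q —[ bnd (binp x) ]→ S
            → (P ∣ Q) —[ nb τ ]→ ν (R ∣ S)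
  res-c   : ∀ {c P R} → P —[ nb (renC push c) ]→ R → ν P —[ nb c ]→ ν R
  res-b   : ∀ {b P R} → P —[ bnd (renB push b) ]→ R → ν P —[ bnd b ]→ ν (ren swap R)
  rep     : ∀ {Γ'} {a : Act Γ Γ'} {P R} → (P ∣ ! P) —[ a ]→ R → ! P —[ a ]→ R

data _≅_ : ∀ {Γ} → Proc Γ → Proc Γ → Set where
  braid₁ : ∀ {Γ} {P : Proc (suc (suc Γ))} → ν (ν (ren swap P)) ≅ ν (ν P)
  braid₂ : ∀ {Γ} {P : Proc (suc (suc Γ))} → ν (ν P) ≅ ν (ν (ren swap P))
  trans≅ : ∀ {Γ} {P Q R : Proc Γ} → P ≅ Q → Q ≅ R → P ≅ R
  𝟘≅     : ∀ {Γ} → 𝟘 {Γ} ≅ 𝟘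
  inp≅   : ∀ {Γ} {x : Fin Γ} {P R} → P ≅ R → inp x P ≅ inp x R
  out≅   : ∀ {Γ} {x y : Fin Γ} {P R} → P ≅ R → out x y P ≅ out x y R
  ν≅     : ∀ {Γ} {P R : Proc (suc Γ)} → P ≅ R → ν P ≅ ν R
  !≅     : ∀ {Γ} {P R : Proc Γ} → P ≅ R → ! P ≅ ! R
  +≅     : ∀ {Γ} {P Q R S : Proc Γ} → P ≅ R → Q ≅ S → (P + Q) ≅ (R + S)
  ∣≅     : ∀ {Γ} {P Q R S : Proc Γ} → P ≅ R → Q ≅ S → (P ∣ Q) ≅ (R ∣ S)

-- A braiding only exchanges two adjacent restricted names, and transitions are
-- stable under renaming, so a transition of ν ν Q is matched by ν ν (swap Q)
-- through its image under swap, with residuals related by a braiding. Everything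
-- else is an induction on the transition, except that transitivity of ≅ does not
-- fit such an induction: a congruence proof is therefore first factored into a
-- chain of steps, each performing braidings in parallel at disjoint positions,
-- and these steps are simulated one at a time.
module Submission where

open import Defs
open import Data.Nat using (ℕ; suc)
open import Data.Fin using (Fin; zero; suc)
open import Data.Product using (Σ; _×_; _,_)
open import Function using (_∘_; id)
open import Relation.Binary.PropositionalEquality
  using (_≡_; _≗_; refl; sym; trans; cong; cong₂; subst)
open import Relation.Binary.Construct.Closure.ReflexiveTransitive
  using (Star; ε; _◅_; _◅◅_; gmap)

lift-cong : ∀ {Γ Δ} {ρ σ : Ren Γ Δ} → ρ ≗ σ → lift ρ ≗ lift σ
lift-cong e zero    = refl
lift-cong e (suc x) = cong suc (e x)

lift-∘ : ∀ {Γ Δ Θ} (ρ : Ren Δ Θ) (σ : Ren Γ Δ) → lift ρ ∘ lift σ ≗ lift (ρ ∘ σ)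
lift-∘ ρ σ zero    = refl
lift-∘ ρ σ (suc x) = refl

lift-id : ∀ {Γ} {ρ : Ren Γ Γ} → ρ ≗ id → lift ρ ≗ id
lift-id e zero    = refl
lift-id e (suc x) = cong suc (e x)

ren-cong : ∀ {Γ Δ} {ρ σ : Ren Γ Δ} → ρ ≗ σ → (P : Proc Γ) → ren ρ P ≡ ren σ P
ren-cong e 𝟘           = refl
ren-cong e (inp x P)   = cong₂ inp (e x) (ren-cong (lift-cong e) P)
ren-cong e (out x y P) rewrite e x | e y = cong (out _ _) (ren-cong e P)
ren-cong e (P + Q)     = cong₂ _+_ (ren-cong e P) (ren-cong e Q)
ren-cong e (P ∣ Q)     = cong₂ _∣_ (ren-cong e P) (ren-cong e Q)
ren-cong e (ν P)       = cong ν (ren-cong (lift-cong e) P)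
ren-cong e (! P)       = cong !_ (ren-cong e P)

ren-∘ : ∀ {Γ Δ Θ} (ρ : Ren Δ Θ) (σ : Ren Γ Δ) (P : Proc Γ) → ren ρ (ren σ P) ≡ ren (ρ ∘ σ) P
ren-∘ ρ σ 𝟘           = refl
ren-∘ ρ σ (inp x P)   = cong (inp _) (trans (ren-∘ (lift ρ) (lift σ) P) (ren-cong (lift-∘ ρ σ) P))
ren-∘ ρ σ (out x y P) = cong (out _ _) (ren-∘ ρ σ P)
ren-∘ ρ σ (P + Q)     = cong₂ _+_ (ren-∘ ρ σ P) (ren-∘ ρ σ Q)
ren-∘ ρ σ (P ∣ Q)     = cong₂ _∣_ (ren-∘ ρ σ P) (ren-∘ ρ σ Q)
ren-∘ ρ σ (ν P)       = cong ν (trans (ren-∘ (lift ρ) (lift σ) P) (ren-cong (lift-∘ ρ σ) P))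
ren-∘ ρ σ (! P)       = cong !_ (ren-∘ ρ σ P)

ren-id : ∀ {Γ} {ρ : Ren Γ Γ} → ρ ≗ id → (P : Proc Γ) → ren ρ P ≡ P
ren-id e 𝟘           = refl
ren-id e (inp x P)   = cong₂ inp (e x) (ren-id (lift-id e) P)
ren-id e (out x y P) rewrite e x | e y = cong (out _ _) (ren-id e P)
ren-id e (P + Q)     = cong₂ _+_ (ren-id e P) (ren-id e Q)
ren-id e (P ∣ Q)     = cong₂ _∣_ (ren-id e P) (ren-id e Q)
ren-id e (ν P)       = cong ν (ren-id (lift-id e) P)
ren-id e (! P)       = cong !_ (ren-id e P)

ren-square : ∀ {Γ Δ Δ' Θ} {ρ : Ren Δ Θ} {σ : Ren Γ Δ} {ρ' : Ren Δ' Θ} {σ' : Ren Γ Δ'}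
           → ρ ∘ σ ≗ ρ' ∘ σ' → (P : Proc Γ) → ren ρ (ren σ P) ≡ ren ρ' (ren σ' P)
ren-square e P = trans (ren-∘ _ _ P) (trans (ren-cong e P) (sym (ren-∘ _ _ P)))

swap-involutive : ∀ {Γ} → swap {Γ} ∘ swap ≗ id
swap-involutive zero          = refl
swap-involutive (suc zero)    = refl
swap-involutive (suc (suc x)) = refl

swap-natural : ∀ {Γ Δ} (ρ : Ren Γ Δ) → lift (lift ρ) ∘ swap ≗ swap ∘ lift (lift ρ)
swap-natural ρ zero          = refl
swap-natural ρ (suc zero)    = refl
swap-natural ρ (suc (suc x)) = refl

swap-braid : ∀ {Γ} → swap {suc Γ} ∘ lift swap ∘ swap ≗ lift swap ∘ swap ∘ lift swap
swap-braid zero                = refl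
swap-braid (suc zero)          = refl
swap-braid (suc (suc zero))    = refl
swap-braid (suc (suc (suc x))) = refl

pop-natural : ∀ {Γ Δ} (ρ : Ren Γ Δ) (y : Fin Γ) → ρ ∘ pop y ≗ pop (ρ y) ∘ lift ρ
pop-natural ρ y zero    = refl
pop-natural ρ y (suc x) = refl

ren-swap-involutive : ∀ {Γ} (P : Proc (suc (suc Γ))) → ren swap (ren swap P) ≡ P
ren-swap-involutive P = trans (ren-∘ swap swap P) (ren-id swap-involutive P)

ren-swap-natural : ∀ {Γ Δ} (ρ : Ren Γ Δ) (P : Proc (suc (suc Γ)))
                 → ren (lift (lift ρ)) (ren swap P) ≡ ren swap (ren (lift (lift ρ)) P)
ren-swap-natural ρ = ren-square (swap-natural ρ)

ren-swap-braid : ∀ {Γ} (P : Proc (suc (suc (suc Γ))))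
               → ren swap (ren (lift swap) (ren swap P)) ≡ ren (lift swap) (ren swap (ren (lift swap) P))
ren-swap-braid P = begin
  ren swap (ren (lift swap) (ren swap P))         ≡⟨ cong (ren swap) (ren-∘ (lift swap) swap P) ⟩
  ren swap (ren (lift swap ∘ swap) P)             ≡⟨ ren-square swap-braid P ⟩
  ren (lift swap) (ren (swap ∘ lift swap) P)      ≡⟨ cong (ren (lift swap)) (sym (ren-∘ swap (lift swap) P)) ⟩
  ren (lift swap) (ren swap (ren (lift swap) P))  ∎
  where open Relation.Binary.PropositionalEquality.≡-Reasoning

ren-pop-natural : ∀ {Γ Δ} (ρ : Ren Γ Δ) (y : Fin Γ) (R : Proc (suc Γ))
                → ren ρ (ren (pop y) R) ≡ ren (pop (ρ y)) (ren (lift ρ) R)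
ren-pop-natural ρ y = ren-square (pop-natural ρ y)

ren-push-natural : ∀ {Γ Δ} (ρ : Ren Γ Δ) (Q : Proc Γ) → ren (lift ρ) (ren push Q) ≡ ren push (ren ρ Q)
ren-push-natural ρ = ren-square (λ _ → refl)

—→-subst : ∀ {Γ Γ'} {P : Proc Γ} {a : Act Γ Γ'} {R R'} → R ≡ R' → P —[ a ]→ R → P —[ a ]→ R'
—→-subst refl E = E

mutual
  ren-—→ᶜ : ∀ {Γ Δ} (ρ : Ren Γ Δ) {P R : Proc Γ} {c}
          → P —[ nb c ]→ R → ren ρ P —[ nb (renC ρ c) ]→ ren ρ R
  ren-—→ᶜ ρ out-ax        = out-ax
  ren-—→ᶜ ρ (sum-l E)     = sum-l (ren-—→ᶜ ρ E)
  ren-—→ᶜ ρ (sum-r E)     = sum-r (ren-—→ᶜ ρ E)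
  ren-—→ᶜ ρ (par-l-c E)   = par-l-c (ren-—→ᶜ ρ E)
  ren-—→ᶜ ρ (par-r-c E)   = par-r-c (ren-—→ᶜ ρ E)
  ren-—→ᶜ ρ (comm-l {y = y} {R = R} E F) =
    —→-subst (cong (_∣ _) (sym (ren-pop-natural ρ y R))) (comm-l (ren-—→ᵇ ρ E) (ren-—→ᶜ ρ F))
  ren-—→ᶜ ρ (comm-r {y = y} {S = S} E F) =
    —→-subst (cong (_ ∣_) (sym (ren-pop-natural ρ y S))) (comm-r (ren-—→ᶜ ρ E) (ren-—→ᵇ ρ F))
  ren-—→ᶜ ρ (close-l E F) = close-l (ren-—→ᵇ ρ E) (ren-—→ᵇ ρ F)
  ren-—→ᶜ ρ (close-r E F) = close-r (ren-—→ᵇ ρ E) (ren-—→ᵇ ρ F)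
  ren-—→ᶜ ρ (res-c {c = cout x y} E) = res-c (ren-—→ᶜ (lift ρ) E)
  ren-—→ᶜ ρ (res-c {c = τ} E)        = res-c (ren-—→ᶜ (lift ρ) E)
  ren-—→ᶜ ρ (rep E)       = rep (ren-—→ᶜ ρ E)

  ren-—→ᵇ : ∀ {Γ Δ} (ρ : Ren Γ Δ) {P : Proc Γ} {R} {b}
          → P —[ bnd b ]→ R → ren ρ P —[ bnd (renB ρ b) ]→ ren (lift ρ) R
  ren-—→ᵇ ρ inp-ax      = inp-ax
  ren-—→ᵇ ρ (sum-l E)   = sum-l (ren-—→ᵇ ρ E)
  ren-—→ᵇ ρ (sum-r E)   = sum-r (ren-—→ᵇ ρ E)
  ren-—→ᵇ ρ (par-l-b {Q = Q} E) =
    —→-subst (cong (_ ∣_) (sym (ren-push-natural ρ Q))) (par-l-b (ren-—→ᵇ ρ E))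
  ren-—→ᵇ ρ (par-r-b {P = P} E) =
    —→-subst (cong (_∣ _) (sym (ren-push-natural ρ P))) (par-r-b (ren-—→ᵇ ρ E))
  ren-—→ᵇ ρ (open-ν E)  = open-ν (ren-—→ᶜ (lift ρ) E)
  ren-—→ᵇ ρ (res-b {b = binp x} {R = R} E) =
    —→-subst (cong ν (sym (ren-swap-natural ρ R))) (res-b (ren-—→ᵇ (lift ρ) E))
  ren-—→ᵇ ρ (res-b {b = bout x} {R = R} E) =
    —→-subst (cong ν (sym (ren-swap-natural ρ R))) (res-b (ren-—→ᵇ (lift ρ) E))
  ren-—→ᵇ ρ (rep E)     = rep (ren-—→ᵇ ρ E)

≅-refl : ∀ {Γ} (P : Proc Γ) → P ≅ P
≅-refl 𝟘           = 𝟘≅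
≅-refl (inp x P)   = inp≅ (≅-refl P)
≅-refl (out x y P) = out≅ (≅-refl P)
≅-refl (P + Q)     = +≅ (≅-refl P) (≅-refl Q)
≅-refl (P ∣ Q)     = ∣≅ (≅-refl P) (≅-refl Q)
≅-refl (ν P)       = ν≅ (≅-refl P)
≅-refl (! P)       = !≅ (≅-refl P)

ren-≅ : ∀ {Γ Δ} (ρ : Ren Γ Δ) {P Q : Proc Γ} → P ≅ Q → ren ρ P ≅ ren ρ Q
ren-≅ ρ (braid₁ {P = P}) =
  subst (λ X → ν (ν X) ≅ ν (ν (ren (lift (lift ρ)) P))) (sym (ren-swap-natural ρ P)) braid₁
ren-≅ ρ (braid₂ {P = P}) =
  subst (λ X → ν (ν (ren (lift (lift ρ)) P)) ≅ ν (ν X)) (sym (ren-swap-natural ρ P)) braid₂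
ren-≅ ρ (trans≅ p q) = trans≅ (ren-≅ ρ p) (ren-≅ ρ q)
ren-≅ ρ 𝟘≅           = 𝟘≅
ren-≅ ρ (inp≅ p)     = inp≅ (ren-≅ (lift ρ) p)
ren-≅ ρ (out≅ p)     = out≅ (ren-≅ ρ p)
ren-≅ ρ (ν≅ p)       = ν≅ (ren-≅ (lift ρ) p)
ren-≅ ρ (!≅ p)       = !≅ (ren-≅ ρ p)
ren-≅ ρ (+≅ p q)     = +≅ (ren-≅ ρ p) (ren-≅ ρ q)
ren-≅ ρ (∣≅ p q)     = ∣≅ (ren-≅ ρ p) (ren-≅ ρ q)

data ParBraid : ∀ {Γ} → Proc Γ → Proc Γ → Set where
  braid₁ : ∀ {Γ} {P : Proc (suc (suc Γ))} → ParBraid (ν (ν (ren swap P))) (ν (ν P))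
  braid₂ : ∀ {Γ} {P : Proc (suc (suc Γ))} → ParBraid (ν (ν P)) (ν (ν (ren swap P)))
  𝟘      : ∀ {Γ} → ParBraid (𝟘 {Γ}) 𝟘
  inp    : ∀ {Γ} {x : Fin Γ} {P R} → ParBraid P R → ParBraid (inp x P) (inp x R)
  out    : ∀ {Γ} {x y : Fin Γ} {P R} → ParBraid P R → ParBraid (out x y P) (out x y R)
  ν      : ∀ {Γ} {P R : Proc (suc Γ)} → ParBraid P R → ParBraid (ν P) (ν R)
  !_     : ∀ {Γ} {P R : Proc Γ} → ParBraid P R → ParBraid (! P) (! R)
  _+_    : ∀ {Γ} {P Q R S : Proc Γ} → ParBraid P R → ParBraid Q S → ParBraid (P + Q) (R + S)
  _∣_    : ∀ {Γ} {P Q R S : Proc Γ} → ParBraid P R → ParBraid Q S → ParBraid (P ∣ Q) (R ∣ S)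

ParBraid-refl : ∀ {Γ} (P : Proc Γ) → ParBraid P P
ParBraid-refl 𝟘           = 𝟘
ParBraid-refl (inp x P)   = inp (ParBraid-refl P)
ParBraid-refl (out x y P) = out (ParBraid-refl P)
ParBraid-refl (P + Q)     = ParBraid-refl P + ParBraid-refl Q
ParBraid-refl (P ∣ Q)     = ParBraid-refl P ∣ ParBraid-refl Q
ParBraid-refl (ν P)       = ν (ParBraid-refl P)
ParBraid-refl (! P)       = ! ParBraid-refl P

ParBraid⇒≅ : ∀ {Γ} {P Q : Proc Γ} → ParBraid P Q → P ≅ Q
ParBraid⇒≅ braid₁  = braid₁
ParBraid⇒≅ braid₂  = braid₂
ParBraid⇒≅ 𝟘       = 𝟘≅
ParBraid⇒≅ (inp s) = inp≅ (ParBraid⇒≅ s)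
ParBraid⇒≅ (out s) = out≅ (ParBraid⇒≅ s)
ParBraid⇒≅ (ν s)   = ν≅ (ParBraid⇒≅ s)
ParBraid⇒≅ (! s)   = !≅ (ParBraid⇒≅ s)
ParBraid⇒≅ (s + t) = +≅ (ParBraid⇒≅ s) (ParBraid⇒≅ t)
ParBraid⇒≅ (s ∣ t) = ∣≅ (ParBraid⇒≅ s) (ParBraid⇒≅ t)

≅⇒ParBraid* : ∀ {Γ} {P Q : Proc Γ} → P ≅ Q → Star ParBraid P Q
≅⇒ParBraid* braid₁       = braid₁ ◅ ε
≅⇒ParBraid* braid₂       = braid₂ ◅ ε
≅⇒ParBraid* (trans≅ p q) = ≅⇒ParBraid* p ◅◅ ≅⇒ParBraid* q
≅⇒ParBraid* 𝟘≅           = 𝟘 ◅ ε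
≅⇒ParBraid* (inp≅ p)     = gmap _ inp (≅⇒ParBraid* p)
≅⇒ParBraid* (out≅ p)     = gmap _ out (≅⇒ParBraid* p)
≅⇒ParBraid* (ν≅ p)       = gmap ν ν (≅⇒ParBraid* p)
≅⇒ParBraid* (!≅ p)       = gmap !_ !_ (≅⇒ParBraid* p)
≅⇒ParBraid* (+≅ {Q = Q} {R = R} p q) =
  gmap (_+ Q) (_+ ParBraid-refl Q) (≅⇒ParBraid* p) ◅◅ gmap (R +_) (ParBraid-refl R +_) (≅⇒ParBraid* q)
≅⇒ParBraid* (∣≅ {Q = Q} {R = R} p q) =
  gmap (_∣ Q) (_∣ ParBraid-refl Q) (≅⇒ParBraid* p) ◅◅ gmap (R ∣_) (ParBraid-refl R ∣_) (≅⇒ParBraid* q)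

Matches : ∀ {Γ Γ'} → Proc Γ → Act Γ Γ' → Proc Γ' → Set
Matches P' a R = Σ (Proc _) (λ R' → (P' —[ a ]→ R') × (R ≅ R'))

braid-matches : ∀ {Γ Γ'} {Q : Proc (suc (suc Γ))} {a : Act Γ Γ'} {R}
              → ν (ν Q) —[ a ]→ R → Matches (ν (ν (ren swap Q))) a R
braid-matches (res-c {c = cout x y} (res-c E)) = _ , res-c (res-c (ren-—→ᶜ swap E)) , braid₂
braid-matches (res-c {c = τ} (res-c E))        = _ , res-c (res-c (ren-—→ᶜ swap E)) , braid₂
braid-matches (open-ν (res-c {R = R} E)) =
  _ , res-b (open-ν (ren-—→ᶜ swap E)) , subst (λ X → ν R ≅ ν X) (sym (ren-swap-involutive R)) (≅-refl _)
braid-matches (res-b {b = bout x} (open-ν E)) = _ , open-ν (res-c (ren-—→ᶜ swap E)) , ≅-refl _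
braid-matches (res-b {b = binp x} (res-b {R = R} E)) =
  _ , res-b (res-b (ren-—→ᵇ swap E)) ,
  subst (λ X → ν (ν (ren (lift swap) (ren swap R))) ≅ ν (ν X)) (ren-swap-braid R) braid₂
braid-matches (res-b {b = bout x} (res-b {R = R} E)) =
  _ , res-b (res-b (ren-—→ᵇ swap E)) ,
  subst (λ X → ν (ν (ren (lift swap) (ren swap R))) ≅ ν (ν X)) (ren-swap-braid R) braid₂

ParBraid-matches : ∀ {Γ Γ'} {P P' : Proc Γ} {a : Act Γ Γ'} {R}
                 → P —[ a ]→ R → ParBraid P P' → Matches P' a R
ParBraid-matches E (braid₁ {P = Q}) with braid-matches E
... | R' , E' , r = R' , subst (λ X → ν (ν X) —[ _ ]→ R') (ren-swap-involutive Q) E' , r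
ParBraid-matches E braid₂ = braid-matches E
ParBraid-matches inp-ax (inp s) = _ , inp-ax , ParBraid⇒≅ s
ParBraid-matches out-ax (out s) = _ , out-ax , ParBraid⇒≅ s
ParBraid-matches (open-ν E) (ν s) with ParBraid-matches E s
... | R' , E' , r = R' , open-ν E' , r
ParBraid-matches (res-c E) (ν s) with ParBraid-matches E s
... | R' , E' , r = _ , res-c E' , ν≅ r
ParBraid-matches (res-b E) (ν s) with ParBraid-matches E s
... | R' , E' , r = _ , res-b E' , ν≅ (ren-≅ swap r)
ParBraid-matches (rep E) (! s) with ParBraid-matches E (s ∣ ! s)
... | R' , E' , r = R' , rep E' , r
ParBraid-matches (sum-l E) (s + t) with ParBraid-matches E s
... | R' , E' , r = R' , sum-l E' , r
ParBraid-matches (sum-r E) (s + t) with ParBraid-matches E t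
... | R' , E' , r = R' , sum-r E' , r
ParBraid-matches (par-l-c E) (s ∣ t) with ParBraid-matches E s
... | R' , E' , r = _ , par-l-c E' , ∣≅ r (ParBraid⇒≅ t)
ParBraid-matches (par-l-b E) (s ∣ t) with ParBraid-matches E s
... | R' , E' , r = _ , par-l-b E' , ∣≅ r (ren-≅ push (ParBraid⇒≅ t))
ParBraid-matches (par-r-c E) (s ∣ t) with ParBraid-matches E t
... | R' , E' , r = _ , par-r-c E' , ∣≅ (ParBraid⇒≅ s) r
ParBraid-matches (par-r-b E) (s ∣ t) with ParBraid-matches E t
... | R' , E' , r = _ , par-r-b E' , ∣≅ (ren-≅ push (ParBraid⇒≅ s)) r
ParBraid-matches (comm-l {y = y} E F) (s ∣ t) with ParBraid-matches E s | ParBraid-matches F t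
... | _ , E' , r | _ , F' , r' = _ , comm-l E' F' , ∣≅ (ren-≅ (pop y) r) r'
ParBraid-matches (comm-r {y = y} E F) (s ∣ t) with ParBraid-matches E s | ParBraid-matches F t
... | _ , E' , r | _ , F' , r' = _ , comm-r E' F' , ∣≅ r (ren-≅ (pop y) r')
ParBraid-matches (close-l E F) (s ∣ t) with ParBraid-matches E s | ParBraid-matches F t
... | _ , E' , r | _ , F' , r' = _ , close-l E' F' , ν≅ (∣≅ r r')
ParBraid-matches (close-r E F) (s ∣ t) with ParBraid-matches E s | ParBraid-matches F t
... | _ , E' , r | _ , F' , r' = _ , close-r E' F' , ν≅ (∣≅ r r')

ParBraid*-matches : ∀ {Γ Γ'} {P P' : Proc Γ} {a : Act Γ Γ'} {R}
                  → P —[ a ]→ R → Star ParBraid P P' → Matches P' a R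
ParBraid*-matches {R = R} E ε = R , E , ≅-refl R
ParBraid*-matches E (s ◅ ss) with ParBraid-matches E s
... | _ , E₁ , r₁ with ParBraid*-matches E₁ ss
... | R₂ , E₂ , r₂ = R₂ , E₂ , trans≅ r₁ r₂

theorem4 : ∀ {Γ Γ' : ℕ} {P P' : Proc Γ} {a : Act Γ Γ'} {R : Proc Γ'}
           → P —[ a ]→ R → P ≅ P'
           → Σ (Proc Γ') (λ R' → (P' —[ a ]→ R') × (R ≅ R'))
theorem4 E p = ParBraid*-matches E (≅⇒ParBraid* p)
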